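{- Suppose that there exists a $4$-GDD of type $4^u$ together with a colouring of its points with $4$ colours such that (a) in any block there are at most two points of the same colour, and (b) in any group there is exactly one point of each colour. Then, for any integer $g \geq 1$, there exists a Kirkman frame of type $(8g)^u$ with a $4$-colouring in which each group is equitably coloured.
   Context: A $k$-GDD is a triple $(V,\mathcal{G},\mathcal{B})$ where $\mathcal{G}$ partitions $V$ into groups and $\mathcal{B}$ is a set of $k$-subsets (blocks) such that every pair of points in different groups lies in exactly one block and no block meets a group in more than one point; type $g^u$ means $u$ groups of size $g$. A Kirkman frame ($3$-frame) is a $3$-GDD with a partition of its blocks into partial parallel classes, each being a partition of $V\setminus G$ for some group $G$. A $4$-colouring is a map from points to $4$ colours such that no block is monochromatic. A set of points is equitably coloured if the numbers of its points of each colour differ by at most one. -}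

module Defs where

open import Data.Nat using (ℕ; zero; suc; _≤_)
open import Data.Fin using (Fin; zero; suc)
open import Data.Fin.Properties using (_≟_)
open import Data.Product using (Σ; ∃; _×_; _,_; proj₁; proj₂)
open import Relation.Nullary using (¬_; does)
open import Relation.Binary.PropositionalEquality using (_≡_; _≢_)
open import Data.Bool using (if_then_else_)

Point : ℕ → ℕ → Set
Point g u = Fin u × Fin g

group : ∀ {g u} → Point g u → Fin u
group = proj₁

Block : ℕ → ℕ → ℕ → Set
Block k g u = Fin k → Point g u

_∈B_ : ∀ {k g u} → Point g u → Block k g u → Set
x ∈B b = ∃ λ s → b s ≡ x

record GDD (k g u : ℕ) : Set where
  field
    m       : ℕ
    blocks  : Fin m → Block k g u
    -- no block meets a group in more than one point (in particular the k points are distinct)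
    transversal : ∀ i s t → group (blocks i s) ≡ group (blocks i t) → s ≡ t
    cover   : ∀ (x y : Point g u) → group x ≢ group y →
              ∃ λ i → x ∈B blocks i × y ∈B blocks i
    unique  : ∀ (x y : Point g u) → group x ≢ group y → ∀ i j →
              x ∈B blocks i → y ∈B blocks i → x ∈B blocks j → y ∈B blocks j → i ≡ j

open GDD public

-- Kirkman frame (3-frame) of type g^u: a 3-GDD together with a partition of its blocks
-- into partial parallel classes, each a partition of V \ G for some group G.
record KirkmanFrame (g u : ℕ) : Set where
  field
    gdd     : GDD 3 g u
    p       : ℕ                               -- number of partial parallel classes
    cls     : Fin (m gdd) → Fin p
    hole    : Fin p → Fin u                   -- the group G missed by each class
    avoids  : ∀ i (x : Point g u) → x ∈B blocks gdd i → group x ≢ hole (cls i)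
    covers  : ∀ (c : Fin p) (x : Point g u) → group x ≢ hole c →
              ∃ λ i → cls i ≡ c × x ∈B blocks gdd i
    disj    : ∀ (c : Fin p) (x : Point g u) i j → cls i ≡ c → cls j ≡ c →
              x ∈B blocks gdd i → x ∈B blocks gdd j → i ≡ j

open KirkmanFrame public

Colouring : ℕ → ℕ → Set
Colouring g u = Point g u → Fin 4

countColour : ∀ {n} → (Fin n → Fin 4) → Fin 4 → ℕ
countColour {zero}  f col = 0
countColour {suc n} f col =
  (if does (f zero ≟ col) then 1 else 0) Data.Nat.+ countColour (λ j → f (suc j)) col

NoMonochromaticBlock : ∀ {k g u} → GDD k g u → Colouring g u → Set
NoMonochromaticBlock G c = ∀ i → ¬ (∀ s t → c (blocks G i s) ≡ c (blocks G i t))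

EquitablyColoured : ∀ {g u} → Colouring g u → Fin u → Set
EquitablyColoured c h =
  ∀ a b → countColour (λ j → c (h , j)) a ≤ suc (countColour (λ j → c (h , j)) b)

AtMostTwoPerColour : ∀ {k g u} → GDD k g u → Colouring g u → Set
AtMostTwoPerColour G c = ∀ i r s t → r ≢ s → s ≢ t → r ≢ t →
  ¬ (c (blocks G i r) ≡ c (blocks G i s) × c (blocks G i s) ≡ c (blocks G i t))

OnePerColourInGroup : ∀ {g u} → Colouring g u → Set
OnePerColourInGroup c = ∀ h col →
  (∃ λ j → c (h , j) ≡ col) × (∀ j j′ → c (h , j) ≡ col → c (h , j′) ≡ col → j ≡ j′)

module Submission where

-- Blow every point of the 4-GDD up into 2g points, so that groups get 8g points, and replace
-- each block B by a Kirkman frame of type (2g)^4 on B × Z_2g whose partial parallel classes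
-- are labelled (H , k), H being the group of the small frame the class misses.  For a point P
-- of the GDD and a label k, the classes (H , k) taken in all blocks through P, with H the
-- position of P in the block, form one partial parallel class missing the group of P: the
-- blocks through P partition the points outside that group.  The small frame is cyclic over
-- Z_2g.  Colouring each new point like the point it comes from, a block of the frame lies
-- over three points of one block of the GDD, not all of one colour by (a), and by (b) every
-- group receives exactly 2g points of each colour.

open import Defs
open import Data.Bool using (if_then_else_)
open import Data.Nat using (ℕ; zero; suc; _+_; _*_; _<_; _≤_; NonZero; pred)
open import Data.Nat.Properties using (suc-pred; +-assoc; +-comm; *-comm; *-assoc; *-zeroʳ; *-identityʳ;
  *-distribˡ-+; 1+n≰n; n≤1+n; +-cancelʳ-≡; *-cancelˡ-≡; suc-injective; even≢odd; m+[n∸m]≡n;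
  m≤m+n; m≤n+m; <-≤-trans; +-monoˡ-<; +-monoʳ-≤; *-monoʳ-<; *-monoʳ-≤; <-irrefl)
open import Data.Nat.DivMod using (_%_; _mod_; %-distribˡ-+; m%n%n≡m%n; [m+n]%n≡m%n; [m+kn]%n≡m%n; m<n⇒m%n≡m)
open import Data.Nat.Tactic.RingSolver using (solve-∀)
open import Data.Fin using (Fin; zero; suc; toℕ; fromℕ<; punchIn; punchOut; opposite; combine; remQuot; _↑ˡ_; _↑ʳ_)
open import Data.Fin.Patterns using (0F; 1F; 2F; 3F)
open import Data.Fin.Properties using (_≟_; toℕ<n; toℕ≤pred[n]; toℕ-fromℕ<; toℕ-injective; any?; injective⇒≤;
  0≢1+n; punchIn-injective; punchInᵢ≢i; punchIn-punchOut; punchOut-injective; opposite-prop; opposite-involutive;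
  remQuot-combine; combine-remQuot; *↔×) renaming (suc-injective to fsuc-injective)
open import Data.Product using (∃; _×_; _,_; proj₁; proj₂; uncurry; swap; map₂; assocʳ′; assocˡ′)
open import Data.Product.Function.NonDependent.Propositional using (_×-↔_)
open import Data.Sum using (_⊎_; inj₁; inj₂)
open import Function using (_∘_; case_of_)
open import Function.Bundles using (_↔_; Inverse)
open import Function.Definitions using (Injective; StrictlySurjective)
open import Function.Properties.Inverse using (↔-refl; ↔-sym; ↔-trans)
open import Relation.Nullary using (¬_; yes; no; does; contradiction)
open import Relation.Binary.PropositionalEquality
open ≡-Reasoning

injective⇒surjective : ∀ {n} {h : Fin n → Fin n} → Injective _≡_ _≡_ h → StrictlySurjective _≡_ h
injective⇒surjective {zero} _ ()
injective⇒surjective {suc n} {h} h-injective y with any? (λ x → h x ≟ y)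
... | yes hit = hit
... | no miss = contradiction (injective⇒≤ squeeze-injective) 1+n≰n
  where
  misses : ∀ x → y ≢ h x
  misses x y≡hx = miss (x , sym y≡hx)
  squeeze : Fin (suc n) → Fin n
  squeeze x = punchOut (misses x)
  squeeze-injective : Injective _≡_ _≡_ squeeze
  squeeze-injective {x} {x′} = h-injective ∘ punchOut-injective (misses x) (misses x′)

[m%n+k]%n≡[m+k]%n : ∀ m k n .{{_ : NonZero n}} → (m % n + k) % n ≡ (m + k) % n
[m%n+k]%n≡[m+k]%n m k n = begin
  (m % n + k) % n            ≡⟨ %-distribˡ-+ (m % n) k n ⟩
  (m % n % n + k % n) % n    ≡⟨ cong (λ r → (r + k % n) % n) (m%n%n≡m%n m n) ⟩
  (m % n + k % n) % n        ≡⟨ %-distribˡ-+ m k n ⟨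
  (m + k) % n                ∎

module _ {n : ℕ} .{{_ : NonZero n}} where

  infixl 6 _⊕_

  opaque
    _⊕_ : Fin n → ℕ → Fin n
    x ⊕ c = (toℕ x + c) mod n

    toℕ-⊕ : ∀ x c → toℕ (x ⊕ c) ≡ (toℕ x + c) % n
    toℕ-⊕ x c = toℕ-fromℕ< _

  ⊕-assoc : ∀ x a b → x ⊕ a ⊕ b ≡ x ⊕ (a + b)
  ⊕-assoc x a b = toℕ-injective (begin
    toℕ (x ⊕ a ⊕ b)               ≡⟨ toℕ-⊕ (x ⊕ a) b ⟩
    (toℕ (x ⊕ a) + b) % n         ≡⟨ cong (λ r → (r + b) % n) (toℕ-⊕ x a) ⟩
    ((toℕ x + a) % n + b) % n     ≡⟨ [m%n+k]%n≡[m+k]%n (toℕ x + a) b n ⟩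
    (toℕ x + a + b) % n           ≡⟨ cong (_% n) (+-assoc (toℕ x) a b) ⟩
    (toℕ x + (a + b)) % n         ≡⟨ toℕ-⊕ x (a + b) ⟨
    toℕ (x ⊕ (a + b))             ∎)

  ⊕-cong : ∀ x {a b} → a % n ≡ b % n → x ⊕ a ≡ x ⊕ b
  ⊕-cong x {a} {b} a≡b = toℕ-injective (begin
    toℕ (x ⊕ a)                    ≡⟨ toℕ-⊕ x a ⟩
    (toℕ x + a) % n                ≡⟨ %-distribˡ-+ (toℕ x) a n ⟩
    (toℕ x % n + a % n) % n        ≡⟨ cong (λ r → (toℕ x % n + r) % n) a≡b ⟩
    (toℕ x % n + b % n) % n        ≡⟨ %-distribˡ-+ (toℕ x) b n ⟨
    (toℕ x + b) % n                ≡⟨ toℕ-⊕ x b ⟨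
    toℕ (x ⊕ b)                    ∎)

  ⊕-undo : ∀ x c → x ⊕ c ⊕ pred n * c ≡ x
  ⊕-undo x c = toℕ-injective (begin
    toℕ (x ⊕ c ⊕ pred n * c)       ≡⟨ cong toℕ (⊕-assoc x c (pred n * c)) ⟩
    toℕ (x ⊕ (c + pred n * c))     ≡⟨ toℕ-⊕ x _ ⟩
    (toℕ x + suc (pred n) * c) % n ≡⟨ cong (λ m → (toℕ x + m * c) % n) (suc-pred n) ⟩
    (toℕ x + n * c) % n            ≡⟨ cong (λ m → (toℕ x + m) % n) (*-comm n c) ⟩
    (toℕ x + c * n) % n            ≡⟨ [m+kn]%n≡m%n (toℕ x) c n ⟩
    toℕ x % n                      ≡⟨ m<n⇒m%n≡m (toℕ<n x) ⟩
    toℕ x                          ∎)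

  ⊕-cancelʳ : ∀ {x y} c → x ⊕ c ≡ y ⊕ c → x ≡ y
  ⊕-cancelʳ {x} {y} c eq = begin
    x                      ≡⟨ ⊕-undo x c ⟨
    x ⊕ c ⊕ pred n * c     ≡⟨ cong (_⊕ pred n * c) eq ⟩
    y ⊕ c ⊕ pred n * c     ≡⟨ ⊕-undo y c ⟩
    y                      ∎

  ⊕-cancelˡ : ∀ x {a b} → a < n → b < n → x ⊕ a ≡ x ⊕ b → a ≡ b
  ⊕-cancelˡ x {a} {b} a<n b<n eq = begin
    a                 ≡⟨ toℕ-fromℕ< a<n ⟨
    toℕ (fromℕ< a<n)  ≡⟨ cong toℕ (⊕-cancelʳ (toℕ x) (toℕ-injective commuted)) ⟩
    toℕ (fromℕ< b<n)  ≡⟨ toℕ-fromℕ< b<n ⟩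
    b                 ∎
    where
    commute : ∀ {d} (d<n : d < n) → toℕ (fromℕ< d<n ⊕ toℕ x) ≡ toℕ (x ⊕ d)
    commute {d} d<n = begin
      toℕ (fromℕ< d<n ⊕ toℕ x)       ≡⟨ toℕ-⊕ (fromℕ< d<n) (toℕ x) ⟩
      (toℕ (fromℕ< d<n) + toℕ x) % n ≡⟨ cong (λ r → (r + toℕ x) % n) (toℕ-fromℕ< d<n) ⟩
      (d + toℕ x) % n                ≡⟨ cong (_% n) (+-comm d (toℕ x)) ⟩
      (toℕ x + d) % n                ≡⟨ toℕ-⊕ x d ⟨
      toℕ (x ⊕ d)                    ∎
    commuted : toℕ (fromℕ< a<n ⊕ toℕ x) ≡ toℕ (fromℕ< b<n ⊕ toℕ x)
    commuted = trans (commute a<n) (trans (cong toℕ eq) (sym (commute b<n)))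

  ⊕-surjective : ∀ c → StrictlySurjective _≡_ (_⊕ c)
  ⊕-surjective c = injective⇒surjective (⊕-cancelʳ c)

module _ {n} {S T : Fin (suc (suc n))} (S≢T : S ≢ T) where

  others : Fin n → Fin (suc (suc n))
  others e = punchIn S (punchIn (punchOut S≢T) e)

  others≢ˡ : ∀ e → others e ≢ S
  others≢ˡ e = punchInᵢ≢i S _

  others≢ʳ : ∀ e → others e ≢ T
  others≢ʳ e eq = punchInᵢ≢i (punchOut S≢T) e
    (punchIn-injective S _ _ (trans eq (sym (punchIn-punchOut S≢T))))

  others-complete : ∀ {H} → H ≢ S → H ≢ T → ∃ λ e → others e ≡ H
  others-complete {H} H≢S H≢T = punchOut t≢j , (begin
    punchIn S (punchIn t (punchOut t≢j))  ≡⟨ cong (punchIn S) (punchIn-punchOut t≢j) ⟩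
    punchIn S j                           ≡⟨ punchIn-punchOut (H≢S ∘ sym) ⟩
    H                                     ∎)
    where
    t j : Fin (suc n)
    t = punchOut S≢T
    j = punchOut (H≢S ∘ sym)
    t≢j : t ≢ j
    t≢j t≡j = H≢T (begin
      H            ≡⟨ punchIn-punchOut (H≢S ∘ sym) ⟨
      punchIn S j  ≡⟨ cong (punchIn S) t≡j ⟨
      punchIn S t  ≡⟨ punchIn-punchOut S≢T ⟩
      T            ∎)

indicator : Fin 4 → Fin 4 → ℕ
indicator a col = if does (a ≟ col) then 1 else 0

countColour-cong : ∀ {N} {F F′ : Fin N → Fin 4} → (∀ j → F j ≡ F′ j) → ∀ col →
                   countColour F col ≡ countColour F′ col
countColour-cong {zero}  F≗F′ col = refl
countColour-cong {suc N} F≗F′ col =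
  cong₂ _+_ (cong (λ a → indicator a col) (F≗F′ zero)) (countColour-cong (λ j → F≗F′ (suc j)) col)

countColour-++ : ∀ m {k} (F : Fin (m + k) → Fin 4) col →
                 countColour F col ≡ countColour (λ j → F (j ↑ˡ k)) col + countColour (λ j → F (m ↑ʳ j)) col
countColour-++ zero    F col = refl
countColour-++ (suc m) F col =
  trans (cong (indicator (F zero) col +_) (countColour-++ m (λ j → F (suc j)) col))
        (sym (+-assoc (indicator (F zero) col) _ _))

countColour-const : ∀ N a col → countColour {N} (λ _ → a) col ≡ N * indicator a col
countColour-const zero    a col = refl
countColour-const (suc N) a col = cong (indicator a col +_) (countColour-const N a col)

countColour-combine : ∀ w {n} (h : Fin (w * n) → Fin 4) (F : Fin w → Fin 4) →
                      (∀ a x → h (combine a x) ≡ F a) → ∀ col →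
                      countColour h col ≡ n * countColour F col
countColour-combine zero    {n} h F h≗F col = sym (*-zeroʳ n)
countColour-combine (suc w) {n} h F h≗F col = begin
  countColour h col
    ≡⟨ countColour-++ n h col ⟩
  countColour (λ j → h (j ↑ˡ w * n)) col + countColour (λ j → h (n ↑ʳ j)) col
    ≡⟨ cong₂ _+_ (countColour-cong (h≗F zero) col) (countColour-combine w _ _ (λ a → h≗F (suc a)) col) ⟩
  countColour {n} (λ _ → F zero) col + n * countColour (λ a → F (suc a)) col
    ≡⟨ cong (_+ n * countColour (λ a → F (suc a)) col) (countColour-const n (F zero) col) ⟩
  n * indicator (F zero) col + n * countColour (λ a → F (suc a)) col
    ≡⟨ *-distribˡ-+ n (indicator (F zero) col) _ ⟨
  n * countColour F col
    ∎

countColour-absent : ∀ {N} (F : Fin N → Fin 4) col → (∀ j → F j ≢ col) → countColour F col ≡ 0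
countColour-absent {zero}  F col absent = refl
countColour-absent {suc N} F col absent with F zero ≟ col
... | yes hit = contradiction hit (absent zero)
... | no _    = countColour-absent (λ j → F (suc j)) col (λ j → absent (suc j))

countColour-unique : ∀ {N} (F : Fin N → Fin 4) col → (∃ λ j → F j ≡ col) →
                     (∀ j j′ → F j ≡ col → F j′ ≡ col → j ≡ j′) → countColour F col ≡ 1
countColour-unique {suc N} F col (zero , hit) unique with F zero ≟ col
... | yes _   = cong suc (countColour-absent (λ j → F (suc j)) col
                            (λ j hit′ → 0≢1+n (unique zero (suc j) hit hit′)))
... | no miss = contradiction hit miss
countColour-unique {suc N} F col (suc j , hit) unique with F zero ≟ col
... | yes hit₀ = contradiction (unique zero (suc j) hit₀ hit) 0≢1+n
... | no _     = countColour-unique (λ j → F (suc j)) col (j , hit)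
                   (λ j j′ hit hit′ → fsuc-injective (unique (suc j) (suc j′) hit hit′))

uniformCount⇒equitablyColoured : ∀ {g u} (c : Colouring g u) h N →
                                 (∀ col → countColour (λ j → c (h , j)) col ≡ N) → EquitablyColoured c h
uniformCount⇒equitablyColoured c h N uniform a b rewrite uniform a | uniform b = n≤1+n N

-- A Kirkman frame with blocks indexed by I and partial parallel classes labelled by
-- Fin u × L, the class (h , l) missing the group h.
record LabelledFrame (g u : ℕ) (I L : Set) : Set where
  field
    blocks      : I → Block 3 g u
    transversal : ∀ i s t → group (blocks i s) ≡ group (blocks i t) → s ≡ t
    cover       : ∀ (x y : Point g u) → group x ≢ group y →
                  ∃ λ i → x ∈B blocks i × y ∈B blocks i
    unique      : ∀ (x y : Point g u) → group x ≢ group y → ∀ i j →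
                  x ∈B blocks i → y ∈B blocks i → x ∈B blocks j → y ∈B blocks j → i ≡ j
    class       : I → Fin u × L
    avoids      : ∀ i (x : Point g u) → x ∈B blocks i → group x ≢ proj₁ (class i)
    covers      : ∀ c (x : Point g u) → group x ≢ proj₁ c →
                  ∃ λ i → class i ≡ c × x ∈B blocks i
    disj        : ∀ c (x : Point g u) i j → class i ≡ c → class j ≡ c →
                  x ∈B blocks i → x ∈B blocks j → i ≡ j

module _ {g u m p : ℕ} {I L : Set} (F : LabelledFrame g u I L)
         (index : I ↔ Fin m) (label : (Fin u × L) ↔ Fin p) where

  private
    module F = LabelledFrame F
    module index = Inverse index
    module label = Inverse label

    from-injective : ∀ {j j′} → index.from j ≡ index.from j′ → j ≡ j′
    from-injective {j} {j′} eq =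
      trans (sym (index.strictlyInverseˡ j)) (trans (cong index.to eq) (index.strictlyInverseˡ j′))

    ∈-from-to : ∀ {x i} → x ∈B F.blocks i → x ∈B F.blocks (index.from (index.to i))
    ∈-from-to {x} {i} = subst (λ i′ → x ∈B F.blocks i′) (sym (index.strictlyInverseʳ i))

    relabel : ∀ {c c′} → label.to c ≡ c′ → c ≡ label.from c′
    relabel {c} refl = sym (label.strictlyInverseʳ c)

    unlabel : ∀ {c c′} → c ≡ label.from c′ → label.to c ≡ c′
    unlabel {c′ = c′} refl = label.strictlyInverseˡ c′

  toKirkmanFrame : KirkmanFrame g u
  toKirkmanFrame = record
    { gdd    = record
      { m           = m
      ; blocks      = λ j → F.blocks (index.from j)
      ; transversal = λ j → F.transversal (index.from j)
      ; cover       = λ x y x≁y → let i , x∈i , y∈i = F.cover x y x≁y in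
                        index.to i , ∈-from-to x∈i , ∈-from-to y∈i
      ; unique      = λ x y x≁y j j′ x∈j y∈j x∈j′ y∈j′ →
                        from-injective (F.unique x y x≁y _ _ x∈j y∈j x∈j′ y∈j′)
      }
    ; p      = p
    ; cls    = λ j → label.to (F.class (index.from j))
    ; hole   = λ c → proj₁ (label.from c)
    ; avoids = λ j x x∈j → subst (λ c → group x ≢ proj₁ c) (relabel refl) (F.avoids (index.from j) x x∈j)
    ; covers = λ c x x≁c → let i , i∈c , x∈i = F.covers (label.from c) x x≁c in
                 index.to i , unlabel (trans (cong F.class (index.strictlyInverseʳ i)) i∈c) , ∈-from-to x∈i
    ; disj   = λ c x j j′ j∈c j′∈c x∈j x∈j′ →
                 from-injective (F.disj (label.from c) x _ _ (relabel j∈c) (relabel j′∈c) x∈j x∈j′)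
    }

module Inflation {k w u n : ℕ} {I L : Set} (G : GDD k w u) (F : LabelledFrame n k I L) where

  private module F = LabelledFrame F

  lift : Point w u → Fin n → Point (w * n) u
  lift P x = group P , combine (proj₂ P) x

  base : Point (w * n) u → Point w u
  base y = group y , proj₁ (remQuot {w} n (proj₂ y))

  offset : Point (w * n) u → Fin n
  offset y = proj₂ (remQuot {w} n (proj₂ y))

  lift-base-offset : ∀ y → lift (base y) (offset y) ≡ y
  lift-base-offset y = cong (group y ,_) (combine-remQuot {w} n (proj₂ y))

  base-lift : ∀ P x → base (lift P x) ≡ P
  base-lift P x = cong (λ ax → group P , proj₁ ax) (remQuot-combine {w} {n} (proj₂ P) x)

  place : Fin (m G) → Point n k → Point (w * n) u
  place i (S , x) = lift (blocks G i S) x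

  inflatedBlocks : Fin (m G) × I → Block 3 (w * n) u
  inflatedBlocks (i , b) s = place i (F.blocks b s)

  ∈-inflated⁺ : ∀ {i b S y} → blocks G i S ≡ base y → (S , offset y) ∈B F.blocks b →
                y ∈B inflatedBlocks (i , b)
  ∈-inflated⁺ {i} {b} {S} {y} S↦y (s , bs≡Sy) = s , (begin
    place i (F.blocks b s)          ≡⟨ cong (place i) bs≡Sy ⟩
    lift (blocks G i S) (offset y)  ≡⟨ cong (λ P → lift P (offset y)) S↦y ⟩
    lift (base y) (offset y)        ≡⟨ lift-base-offset y ⟩
    y                               ∎)

  ∈-inflated⁻ : ∀ {i b y} → y ∈B inflatedBlocks (i , b) →
                ∃ λ S → blocks G i S ≡ base y × (S , offset y) ∈B F.blocks b
  ∈-inflated⁻ {i} {b} (s , refl) =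
    group (F.blocks b s) ,
    sym (base-lift (blocks G i (group (F.blocks b s))) (proj₂ (F.blocks b s))) ,
    s , cong (group (F.blocks b s) ,_) (sym (cong proj₂ (remQuot-combine {w} {n} _ (proj₂ (F.blocks b s)))))

  position-unique : ∀ {i S S′ P} → blocks G i S ≡ P → blocks G i S′ ≡ P → S ≡ S′
  position-unique {i} S↦P S′↦P = transversal G i _ _ (cong group (trans S↦P (sym S′↦P)))

  positions-distinct : ∀ {i S T P Q} → blocks G i S ≡ P → blocks G i T ≡ Q → group P ≢ group Q → S ≢ T
  positions-distinct S↦P T↦Q P≁Q refl = P≁Q (cong group (trans (sym S↦P) T↦Q))

  inflatedClass : Fin (m G) × I → Fin u × (Fin w × L)
  inflatedClass (i , b) = assocʳ′ (blocks G i (proj₁ (F.class b)) , proj₂ (F.class b))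

  inflatedClass-injective : ∀ {i b i′ b′} → inflatedClass (i , b) ≡ inflatedClass (i′ , b′) →
                            blocks G i (proj₁ (F.class b)) ≡ blocks G i′ (proj₁ (F.class b′)) ×
                            proj₂ (F.class b) ≡ proj₂ (F.class b′)
  inflatedClass-injective eq = cong (proj₁ ∘ assocˡ′) eq , cong (proj₂ ∘ assocˡ′) eq

  inflate : LabelledFrame (w * n) u (Fin (m G) × I) (Fin w × L)
  inflate = record
    { blocks      = inflatedBlocks
    ; transversal = λ { (i , b) s t → F.transversal b s t ∘ transversal G i _ _ }
    ; cover       = cover′
    ; unique      = unique′
    ; class       = inflatedClass
    ; avoids      = avoids′
    ; covers      = covers′
    ; disj        = disj′
    }
    where
    cover′ : ∀ y z → group y ≢ group z → ∃ λ ib → y ∈B inflatedBlocks ib × z ∈B inflatedBlocks ib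
    cover′ y z y≁z with i , (S , S↦y) , (T , T↦z) ← cover G (base y) (base z) y≁z
                    with b , y∈b , z∈b ← F.cover (S , offset y) (T , offset z) (positions-distinct S↦y T↦z y≁z)
      = (i , b) , ∈-inflated⁺ S↦y y∈b , ∈-inflated⁺ T↦z z∈b

    unique′ : ∀ y z → group y ≢ group z → ∀ ib ib′ →
              y ∈B inflatedBlocks ib → z ∈B inflatedBlocks ib → y ∈B inflatedBlocks ib′ → z ∈B inflatedBlocks ib′ →
              ib ≡ ib′
    unique′ y z y≁z (i , b) (i′ , b′) y∈ z∈ y∈′ z∈′
      with S , S↦y , y∈b ← ∈-inflated⁻ y∈ | T , T↦z , z∈b ← ∈-inflated⁻ z∈
         | S′ , S′↦y , y∈b′ ← ∈-inflated⁻ y∈′ | T′ , T′↦z , z∈b′ ← ∈-inflated⁻ z∈′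
      with refl ← unique G (base y) (base z) y≁z i i′ (S , S↦y) (T , T↦z) (S′ , S′↦y) (T′ , T′↦z)
      with refl ← position-unique S↦y S′↦y | refl ← position-unique T↦z T′↦z
      = cong (i ,_) (F.unique _ _ (positions-distinct S↦y T↦z y≁z) b b′ y∈b z∈b y∈b′ z∈b′)

    avoids′ : ∀ ib y → y ∈B inflatedBlocks ib → group y ≢ proj₁ (inflatedClass ib)
    avoids′ (i , b) y y∈ y~hole with S , S↦y , y∈b ← ∈-inflated⁻ y∈ =
      F.avoids b _ y∈b (transversal G i _ _ (trans (cong group S↦y) y~hole))

    covers′ : ∀ c y → group y ≢ proj₁ c → ∃ λ ib → inflatedClass ib ≡ c × y ∈B inflatedBlocks ib
    covers′ (h , a , l) y y≁h with i , (H , H↦ha) , (S , S↦y) ← cover G (h , a) (base y) (y≁h ∘ sym)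
                               with b , b∈Hl , y∈b ← F.covers (H , l) (S , offset y) (positions-distinct S↦y H↦ha y≁h)
      = (i , b) ,
        trans (cong (λ Hl → assocʳ′ (blocks G i (proj₁ Hl) , proj₂ Hl)) b∈Hl) (cong (λ P → assocʳ′ (P , l)) H↦ha) ,
        ∈-inflated⁺ S↦y y∈b

    disj′ : ∀ c y ib ib′ → inflatedClass ib ≡ c → inflatedClass ib′ ≡ c →
            y ∈B inflatedBlocks ib → y ∈B inflatedBlocks ib′ → ib ≡ ib′
    disj′ c y (i , b) (i′ , b′) ib∈c ib′∈c y∈ y∈′
      with same-hole , same-label ← inflatedClass-injective (trans ib∈c (sym ib′∈c))
      with S , S↦y , y∈b ← ∈-inflated⁻ y∈ | S′ , S′↦y , y∈b′ ← ∈-inflated⁻ y∈′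
      with refl ← unique G _ (base y) (λ eq → avoids′ (i , b) y y∈ (sym eq)) i i′
                    (_ , refl) (S , S↦y) (_ , sym same-hole) (S′ , S′↦y)
      with refl ← position-unique S↦y S′↦y
      = cong (i ,_) (F.disj _ _ b b′ (cong₂ _,_ (position-unique refl (sym same-hole)) same-label) refl y∈b y∈b′)

  inflateColouring : Colouring w u → Colouring (w * n) u
  inflateColouring c y = c (base y)

  inflated-noMonochromatic : ∀ c → AtMostTwoPerColour G c → ∀ ib →
    ¬ (∀ s t → inflateColouring c (inflatedBlocks ib s) ≡ inflateColouring c (inflatedBlocks ib t))
  inflated-noMonochromatic c atMostTwo (i , b) mono =
    atMostTwo i (S 0F) (S 1F) (S 2F) (distinct λ ()) (distinct λ ()) (distinct λ ()) (same 0F 1F , same 1F 2F)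
    where
    S : Fin 3 → Fin k
    S s = group (F.blocks b s)
    distinct : ∀ {s t} → s ≢ t → S s ≢ S t
    distinct s≢t = s≢t ∘ F.transversal b _ _
    colour-place : ∀ s → inflateColouring c (inflatedBlocks (i , b) s) ≡ c (blocks G i (S s))
    colour-place s = cong c (base-lift (blocks G i (S s)) (proj₂ (F.blocks b s)))
    same : ∀ s t → c (blocks G i (S s)) ≡ c (blocks G i (S t))
    same s t = trans (sym (colour-place s)) (trans (mono s t) (colour-place t))

  inflated-countColour : ∀ c h col → countColour (λ j → inflateColouring c (h , j)) col ≡
                                     n * countColour (λ a → c (h , a)) col
  inflated-countColour c h col =
    countColour-combine w _ _ (λ a x → cong (λ ax → c (h , proj₁ ax)) (remQuot-combine a x)) col

opposite-injective : ∀ {n} → Injective _≡_ _≡_ (opposite {n})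
opposite-injective {_} {i} {j} eq =
  trans (sym (opposite-involutive i)) (trans (cong opposite eq) (opposite-involutive j))

data _≺_ : Fin 4 → Fin 4 → Set where
  0≺1 : 0F ≺ 1F
  0≺2 : 0F ≺ 2F
  0≺3 : 0F ≺ 3F
  1≺2 : 1F ≺ 2F
  1≺3 : 1F ≺ 3F
  2≺3 : 2F ≺ 3F

≺⇒≢ : ∀ {S T} → S ≺ T → S ≢ T
≺⇒≢ 0≺1 ()
≺⇒≢ 0≺2 ()
≺⇒≢ 0≺3 ()
≺⇒≢ 1≺2 ()
≺⇒≢ 1≺3 ()
≺⇒≢ 2≺3 ()

≢⇒≺⊎≻ : ∀ {S T} → S ≢ T → S ≺ T ⊎ T ≺ S
≢⇒≺⊎≻ {0F} {0F} S≢T = contradiction refl S≢T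
≢⇒≺⊎≻ {0F} {1F} _   = inj₁ 0≺1
≢⇒≺⊎≻ {0F} {2F} _   = inj₁ 0≺2
≢⇒≺⊎≻ {0F} {3F} _   = inj₁ 0≺3
≢⇒≺⊎≻ {1F} {0F} _   = inj₂ 0≺1
≢⇒≺⊎≻ {1F} {1F} S≢T = contradiction refl S≢T
≢⇒≺⊎≻ {1F} {2F} _   = inj₁ 1≺2
≢⇒≺⊎≻ {1F} {3F} _   = inj₁ 1≺3
≢⇒≺⊎≻ {2F} {0F} _   = inj₂ 0≺2
≢⇒≺⊎≻ {2F} {1F} _   = inj₂ 1≺2
≢⇒≺⊎≻ {2F} {2F} S≢T = contradiction refl S≢T
≢⇒≺⊎≻ {2F} {3F} _   = inj₁ 2≺3
≢⇒≺⊎≻ {3F} {0F} _   = inj₂ 0≺3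
≢⇒≺⊎≻ {3F} {1F} _   = inj₂ 1≺3
≢⇒≺⊎≻ {3F} {2F} _   = inj₂ 2≺3
≢⇒≺⊎≻ {3F} {3F} S≢T = contradiction refl S≢T

pick : ∀ {A B : Set} → (A → B) → (A → B) → Fin 2 → A → B
pick a b 0F = a
pick a b 1F = b

pick-injective : ∀ {A B : Set} {a b : A → B} → Injective _≡_ _≡_ a → Injective _≡_ _≡_ b →
                 (∀ k k′ → a k ≢ b k′) → Injective _≡_ _≡_ (uncurry (pick a b))
pick-injective a-inj b-inj a≢b {0F , _} {0F , _} eq = cong (0F ,_) (a-inj eq)
pick-injective a-inj b-inj a≢b {0F , _} {1F , _} eq = contradiction eq (a≢b _ _)
pick-injective a-inj b-inj a≢b {1F , _} {0F , _} eq = contradiction (sym eq) (a≢b _ _)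
pick-injective a-inj b-inj a≢b {1F , _} {1F , _} eq = cong (1F ,_) (b-inj eq)

pick-< : ∀ {A : Set} {a b : A → ℕ} {n} → (∀ k → a k < n) → (∀ k → b k < n) → ∀ e k → pick a b e k < n
pick-< a<n b<n 0F = a<n
pick-< a<n b<n 1F = b<n

module Cyclic (g′ : ℕ) where

  g n : ℕ
  g = suc g′
  n = 2 * g

  low high rev even odd : Fin g → ℕ
  low k  = toℕ k
  high k = toℕ k + g
  rev k  = toℕ (opposite k)
  even k = 2 * toℕ k
  odd k  = suc (2 * toℕ k)

  -- The base block (H , k) misses group H and meets group S ≠ H in baseValue H k S; its
  -- translates by Z_2g form the partial parallel class (H , k).
  baseValue : Fin 4 → Fin g → Fin 4 → ℕ
  baseValue 0F k 1F = 0
  baseValue 0F k 2F = high k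
  baseValue 0F k 3F = even k
  baseValue 1F k 0F = 0
  baseValue 1F k 2F = odd k
  baseValue 1F k 3F = high k
  baseValue 2F k 0F = 0
  baseValue 2F k 1F = high k
  baseValue 2F k 3F = rev k
  baseValue 3F k 0F = 0
  baseValue 3F k 1F = low k
  baseValue 3F k 2F = even k
  baseValue _  _ _  = 0

  -- For S ≺ T the base blocks meeting both S and T are those with H = others e, and Δ p e k is
  -- their difference between T and S modulo 2g.  These differences run through Z_2g exactly
  -- once, as {k} ∪ {k + g}, {2k} ∪ {2k + 1} or {g - 1 - k} ∪ {k + g}.
  Δ : ∀ {S T} → S ≺ T → Fin 2 → Fin g → ℕ
  Δ 0≺1 = pick high low
  Δ 0≺2 = pick odd even
  Δ 0≺3 = pick high rev
  Δ 1≺2 = pick high low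
  Δ 1≺3 = pick even (odd ∘ opposite)
  Δ 2≺3 = pick high rev

  low+rev : ∀ k → low k + rev k ≡ g′
  low+rev k = trans (cong (toℕ k +_) (opposite-prop k)) (m+[n∸m]≡n (toℕ≤pred[n] k))

  Δ-difference : ∀ {S T} (p : S ≺ T) e k →
                 (baseValue (others (≺⇒≢ p) e) k S + Δ p e k) % n ≡ baseValue (others (≺⇒≢ p) e) k T % n
  Δ-difference 0≺1 0F k = refl
  Δ-difference 0≺1 1F k = refl
  Δ-difference 0≺2 0F k = refl
  Δ-difference 0≺2 1F k = refl
  Δ-difference 0≺3 0F k = refl
  Δ-difference 0≺3 1F k = refl
  Δ-difference 1≺2 0F k = refl
  Δ-difference 1≺2 1F k = cong (_% n) (double (toℕ k))
    where
    double : ∀ a → a + a ≡ 2 * a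
    double = solve-∀
  Δ-difference 1≺3 0F k = refl
  Δ-difference 1≺3 1F k = begin
    (low k + suc g′ + suc (2 * rev k)) % n                    ≡⟨ cong (λ h → (low k + suc h + suc (2 * rev k)) % n) (low+rev k) ⟨
    (low k + suc (low k + rev k) + suc (2 * rev k)) % n       ≡⟨ cong (_% n) (identity (low k) (rev k)) ⟩
    (rev k + 2 * suc (low k + rev k)) % n                     ≡⟨ cong (λ h → (rev k + 2 * suc h) % n) (low+rev k) ⟩
    (rev k + n) % n                                           ≡⟨ [m+n]%n≡m%n (rev k) n ⟩
    rev k % n                                                 ∎
    where
    identity : ∀ a b → a + suc (a + b) + suc (2 * b) ≡ b + 2 * suc (a + b)
    identity = solve-∀
  Δ-difference 2≺3 0F k = trans (cong (_% n) (identity (toℕ k) g)) ([m+n]%n≡m%n (even k) n)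
    where
    identity : ∀ a b → a + b + (a + b) ≡ 2 * a + 2 * b
    identity = solve-∀
  Δ-difference 2≺3 1F k = cong (_% n) (begin
    odd k + rev k                  ≡⟨ identity (low k) (rev k) ⟩
    low k + suc (low k + rev k)    ≡⟨ cong (λ h → low k + suc h) (low+rev k) ⟩
    low k + g                      ∎)
    where
    identity : ∀ a b → suc (2 * a) + b ≡ a + suc (a + b)
    identity = solve-∀

  g≤n : g ≤ n
  g≤n = m≤m+n g (g + 0)

  <g⇒<n : ∀ {a} → a < g → a < n
  <g⇒<n a<g = <-≤-trans a<g g≤n

  high<n : ∀ k → high k < n
  high<n k = <-≤-trans (+-monoˡ-< g (toℕ<n k)) (+-monoʳ-≤ g (m≤m+n g 0))

  even<n : ∀ k → even k < n
  even<n k = *-monoʳ-< 2 (toℕ<n k)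

  odd<n : ∀ k → odd k < n
  odd<n k = subst (_≤ n) (identity (toℕ k)) (*-monoʳ-≤ 2 (toℕ<n k))
    where
    identity : ∀ a → 2 * suc a ≡ suc (suc (2 * a))
    identity = solve-∀

  Δ<n : ∀ {S T} (p : S ≺ T) e k → Δ p e k < n
  Δ<n 0≺1 = pick-< high<n (<g⇒<n ∘ toℕ<n)
  Δ<n 0≺2 = pick-< odd<n even<n
  Δ<n 0≺3 = pick-< high<n (<g⇒<n ∘ toℕ<n ∘ opposite)
  Δ<n 1≺2 = pick-< high<n (<g⇒<n ∘ toℕ<n)
  Δ<n 1≺3 = pick-< even<n (odd<n ∘ opposite)
  Δ<n 2≺3 = pick-< high<n (<g⇒<n ∘ toℕ<n ∘ opposite)

  low-injective : Injective _≡_ _≡_ low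
  low-injective = toℕ-injective

  high-injective : Injective _≡_ _≡_ high
  high-injective = toℕ-injective ∘ +-cancelʳ-≡ g _ _

  rev-injective : Injective _≡_ _≡_ rev
  rev-injective = opposite-injective ∘ toℕ-injective

  even-injective : Injective _≡_ _≡_ even
  even-injective = toℕ-injective ∘ *-cancelˡ-≡ _ _ 2

  odd-injective : Injective _≡_ _≡_ odd
  odd-injective = even-injective ∘ suc-injective

  high≢<g : ∀ {a} k → a < g → high k ≢ a
  high≢<g {a} k a<g high≡a = <-irrefl refl (<-≤-trans a<g (subst (g ≤_) high≡a (m≤n+m g (toℕ k))))

  Δ-injective : ∀ {S T} (p : S ≺ T) → Injective _≡_ _≡_ (uncurry (Δ p))
  Δ-injective 0≺1 = pick-injective high-injective low-injective (λ k k′ → high≢<g k (toℕ<n k′))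
  Δ-injective 0≺2 = pick-injective odd-injective even-injective (λ k k′ → even≢odd (toℕ k′) (toℕ k) ∘ sym)
  Δ-injective 0≺3 = pick-injective high-injective rev-injective (λ k k′ → high≢<g k (toℕ<n (opposite k′)))
  Δ-injective 1≺2 = pick-injective high-injective low-injective (λ k k′ → high≢<g k (toℕ<n k′))
  Δ-injective 1≺3 = pick-injective even-injective (opposite-injective ∘ odd-injective)
                                   (λ k k′ → even≢odd (toℕ k) (toℕ (opposite k′)))
  Δ-injective 2≺3 = pick-injective high-injective rev-injective (λ k k′ → high≢<g k (toℕ<n (opposite k′)))

  Index : Set
  Index = Fin 4 × Fin g × Fin n

  cyclicBlocks : Index → Block 3 n 4
  cyclicBlocks (H , k , x) s = punchIn H s , x ⊕ baseValue H k (punchIn H s)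

  ∈-cyclic⁺ : ∀ {H k x S} → H ≢ S → (S , x ⊕ baseValue H k S) ∈B cyclicBlocks (H , k , x)
  ∈-cyclic⁺ {H} {k} {x} H≢S =
    punchOut H≢S , cong (λ S → S , x ⊕ baseValue H k S) (punchIn-punchOut H≢S)

  ∈-cyclic⁻ : ∀ {H k x S y} → (S , y) ∈B cyclicBlocks (H , k , x) → H ≢ S × x ⊕ baseValue H k S ≡ y
  ∈-cyclic⁻ {H} (s , refl) = punchInᵢ≢i H s ∘ sym , refl

  translate-Δ : ∀ {S T} (p : S ≺ T) e k x →
                x ⊕ baseValue (others (≺⇒≢ p) e) k T ≡ x ⊕ baseValue (others (≺⇒≢ p) e) k S ⊕ Δ p e k
  translate-Δ p e k x = trans (⊕-cong x (sym (Δ-difference p e k))) (sym (⊕-assoc x _ _))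

  cover≺ : ∀ {S T} → S ≺ T → ∀ y z → ∃ λ i → (S , y) ∈B cyclicBlocks i × (T , z) ∈B cyclicBlocks i
  cover≺ {S} {T} p y z =
    (H , k , x) , subst (λ y′ → (S , y′) ∈B cyclicBlocks (H , k , x)) x↦y (∈-cyclic⁺ {H} {k} {x} (others≢ˡ S≢T e))
                , subst (λ z′ → (T , z′) ∈B cyclicBlocks (H , k , x)) x↦z (∈-cyclic⁺ {H} {k} {x} (others≢ʳ S≢T e))
    where
    S≢T : S ≢ T
    S≢T = ≺⇒≢ p
    step : Fin n → Fin n
    step w = y ⊕ uncurry (Δ p) (remQuot {2} g w)
    step-injective : Injective _≡_ _≡_ step
    step-injective {w} {w′} eq = begin
      w                                   ≡⟨ combine-remQuot {2} g w ⟨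
      uncurry combine (remQuot {2} g w)   ≡⟨ cong (uncurry combine) (Δ-injective p (⊕-cancelˡ y (Δ<n p _ _) (Δ<n p _ _) eq)) ⟩
      uncurry combine (remQuot {2} g w′)  ≡⟨ combine-remQuot {2} g w′ ⟩
      w′                                  ∎
    w : Fin n
    w = proj₁ (injective⇒surjective step-injective z)
    e : Fin 2
    e = proj₁ (remQuot {2} g w)
    k : Fin g
    k = proj₂ (remQuot {2} g w)
    H : Fin 4
    H = others S≢T e
    x : Fin n
    x = proj₁ (⊕-surjective (baseValue H k S) y)
    x↦y : x ⊕ baseValue H k S ≡ y
    x↦y = proj₂ (⊕-surjective (baseValue H k S) y)
    x↦z : x ⊕ baseValue H k T ≡ z
    x↦z = begin
      x ⊕ baseValue H k T              ≡⟨ translate-Δ p e k x ⟩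
      x ⊕ baseValue H k S ⊕ Δ p e k    ≡⟨ cong (_⊕ Δ p e k) x↦y ⟩
      y ⊕ Δ p e k                      ≡⟨ proj₂ (injective⇒surjective step-injective z) ⟩
      z                                ∎

  Δ-between : ∀ {S T} (p : S ≺ T) {e k x y z} →
            x ⊕ baseValue (others (≺⇒≢ p) e) k S ≡ y → x ⊕ baseValue (others (≺⇒≢ p) e) k T ≡ z →
            y ⊕ Δ p e k ≡ z
  Δ-between p {e} {k} {x} x↦y x↦z = trans (cong (_⊕ Δ p e k) (sym x↦y)) (trans (sym (translate-Δ p e k x)) x↦z)

  unique≺ : ∀ {S T} → S ≺ T → ∀ y z i i′ →
            (S , y) ∈B cyclicBlocks i → (T , z) ∈B cyclicBlocks i →
            (S , y) ∈B cyclicBlocks i′ → (T , z) ∈B cyclicBlocks i′ → i ≡ i′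
  unique≺ p y z (H , k , x) (H′ , k′ , x′) y∈ z∈ y∈′ z∈′
    with H≢S , x↦y ← ∈-cyclic⁻ y∈ | H≢T , x↦z ← ∈-cyclic⁻ z∈
       | H′≢S , x′↦y ← ∈-cyclic⁻ y∈′ | H′≢T , x′↦z ← ∈-cyclic⁻ z∈′
    with e , refl ← others-complete (≺⇒≢ p) H≢S H≢T | e′ , refl ← others-complete (≺⇒≢ p) H′≢S H′≢T
    with refl ← Δ-injective p {e , k} {e′ , k′} (⊕-cancelˡ y (Δ<n p e k) (Δ<n p e′ k′)
                                     (trans (Δ-between p x↦y x↦z) (sym (Δ-between p x′↦y x′↦z))))
    = cong (λ x → H , k , x) (⊕-cancelʳ _ (trans x↦y (sym x′↦y)))

  cyclicFrame : LabelledFrame n 4 Index (Fin g)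
  cyclicFrame = record
    { blocks      = cyclicBlocks
    ; transversal = λ { (H , _ , _) → punchIn-injective H }
    ; cover       = λ { (S , y) (T , z) S≢T → case ≢⇒≺⊎≻ S≢T of λ
                      { (inj₁ p) → cover≺ p y z
                      ; (inj₂ p) → map₂ swap (cover≺ p z y) } }
    ; unique      = λ { (S , y) (T , z) S≢T i i′ y∈ z∈ y∈′ z∈′ → case ≢⇒≺⊎≻ S≢T of λ
                      { (inj₁ p) → unique≺ p y z i i′ y∈ z∈ y∈′ z∈′
                      ; (inj₂ p) → unique≺ p z y i i′ z∈ y∈ z∈′ y∈′ } }
    ; class       = λ { (H , k , _) → H , k }
    ; avoids      = λ { (H , k , x) (S , y) y∈ → proj₁ (∈-cyclic⁻ y∈) ∘ sym }
    ; covers      = λ { (H , k) (S , y) S≢H → let x , x↦y = ⊕-surjective (baseValue H k S) y in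
                      (H , k , x) , refl ,
                      subst (λ y′ → (S , y′) ∈B cyclicBlocks (H , k , x)) x↦y (∈-cyclic⁺ (S≢H ∘ sym)) }
    ; disj        = λ { _ (S , y) (H , k , x) (H′ , k′ , x′) refl refl y∈ y∈′ →
                      cong (λ x → H , k , x)
                           (⊕-cancelʳ _ (trans (proj₂ (∈-cyclic⁻ y∈)) (sym (proj₂ (∈-cyclic⁻ y∈′))))) }
    }

EquitablyColouredKirkmanFrame : ℕ → ℕ → Set
EquitablyColouredKirkmanFrame N u =
  ∃ λ (F : KirkmanFrame N u) → ∃ λ (c : Colouring N u) →
    NoMonochromaticBlock (gdd F) c × (∀ h → EquitablyColoured c h)

×↔* : ∀ {a b} → (Fin a × Fin b) ↔ Fin (a * b)
×↔* = ↔-sym *↔×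

inflatedKirkmanFrame : ∀ {k u n mᵢ r} {I L : Set} (G : GDD k 4 u) (c : Colouring 4 u) →
  AtMostTwoPerColour G c → OnePerColourInGroup c →
  LabelledFrame n k I L → I ↔ Fin mᵢ → L ↔ Fin r → EquitablyColouredKirkmanFrame (4 * n) u
inflatedKirkmanFrame {u = u} {n} {mᵢ} {r} {I} {L} G c atMostTwo onePerColour F index label =
  toKirkmanFrame inflate blockIndex classLabel ,
  inflateColouring c ,
  (λ j → inflated-noMonochromatic c atMostTwo (Inverse.from blockIndex j)) ,
  λ h → uniformCount⇒equitablyColoured (inflateColouring c) h n λ col → begin
    countColour (λ j → inflateColouring c (h , j)) col  ≡⟨ inflated-countColour c h col ⟩
    n * countColour (λ a → c (h , a)) col              ≡⟨ cong (n *_) (uncurry (countColour-unique _ col) (onePerColour h col)) ⟩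
    n * 1                                              ≡⟨ *-identityʳ n ⟩
    n                                                  ∎
  where
  open Inflation G F
  blockIndex : (Fin (m G) × I) ↔ Fin (m G * mᵢ)
  blockIndex = ↔-trans (↔-refl ×-↔ index) ×↔*
  classLabel : (Fin u × Fin 4 × L) ↔ Fin (u * (4 * r))
  classLabel = ↔-trans (↔-refl ×-↔ (↔-refl ×-↔ label)) (↔-trans (↔-refl ×-↔ ×↔*) ×↔*)

lemma4p1 : ∀ (u : ℕ) →
    (∃ λ (G : GDD 4 4 u) → ∃ λ (c : Colouring 4 u) →
       AtMostTwoPerColour G c × OnePerColourInGroup c) →
    ∀ (g : ℕ) → 1 ≤ g →
    ∃ λ (F : KirkmanFrame (8 * g) u) → ∃ λ (c : Colouring (8 * g) u) →
      NoMonochromaticBlock (gdd F) c × (∀ h → EquitablyColoured c h)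
lemma4p1 u (G , c , atMostTwo , onePerColour) (suc g′) _ =
  subst (λ N → EquitablyColouredKirkmanFrame N u) (sym (*-assoc 4 2 (suc g′)))
    (inflatedKirkmanFrame G c atMostTwo onePerColour cyclicFrame
       (↔-trans (↔-refl ×-↔ ×↔*) ×↔*) ↔-refl)
  where open Cyclic g′
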